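{- Let $s$ be a consistent sign pattern with $s(u_{n2})=-$. Let $\alpha$ be the dihedral ordering $2,1,3,4,\dots,n$ (obtained by swapping $1$ and $2$), and let $t$ be the transport of $s$ to $\alpha$. Then $N(t)<N(s)$.
   Context: $\mathcal{M}_{0,n}$ is the moduli space of $n$ distinct labeled points $z_1,\dots,z_n$ on $\mathbb{P}^1$ modulo $\mathrm{PGL}_2$, $[ij|kl]=\frac{(z_i-z_k)(z_j-z_l)}{(z_i-z_l)(z_j-z_k)}$. Positions/labels are cyclic mod $n$; a chord is an unordered pair $\{p,q\}$ with $q\notin\{p-1,p,p+1\}$. Standard dihedral coordinates: $u_{ij}=[i,i+1|j+1,j]$ for chords $ij$ ($u_{ij}=u_{ji}$). For a dihedral ordering $\alpha$ (bijection from positions to labels, one-line $\alpha(1),\dots,\alpha(n)$) set $u^\alpha_{pq}=[\alpha(p),\alpha(p+1)|\alpha(q+1),\alpha(q)]$. A sign pattern $s$ assigns $\pm$ to each standard coordinate $u_{ij}$; $N(s)$ is the number of chords with $s(u_{ij})=-$. Consistency: for every partition of the labels into four non-empty cyclic intervals $A,B,C,D$ in cyclic order, the extended $u$-relation $\prod_{i\in A,j\in C}u_{ij}+\prod_{k\in B,l\in D}u_{kl}=1$ holds on $\mathcal{M}_{0,n}$, and $s$ is consistent if for no such partition both monomials have sign $-$ (sign of a monomial = product of the signs of its factors). Transport: each function $u^\alpha_{pq}$ on $\mathcal{M}_{0,n}$ can be written uniquely as $\varepsilon\prod u_{kl}^{e_{kl}}$ with $\varepsilon\in\{\pm1\}$,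 $e_{kl}\in\mathbb{Z}$; the transport $t$ of $s$ to $\alpha$ is the sign pattern on the chords of the $\alpha$-labeled polygon with $t(u^\alpha_{pq})=\varepsilon\prod s(u_{kl})^{e_{kl}}$; $N(t)$ is its number of negative entries. For $\alpha=2,1,3,\dots,n$, writing $v_{\alpha(p)\alpha(q)}:=u^\alpha_{pq}$, these expressions are: $v_{ij}=u_{ij}$ for $i,j\notin\{n,1,2\}$; $v_{ni}=u_{ni}u_{1i}$, $v_{1i}=u_{1i}u_{2i}$, $v_{2i}=u_{1i}^{ -1}$ for $i\notin\{n,1,2\}$; and $v_{n1}=-u_{n2}\prod_{i\notin\{n,1,2\}}u_{1i}^{ -1}$. -}

module Defs where

open import Data.Bool using (Bool; true; false; if_then_else_; _∧_; _∨_; not)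
open import Data.Nat using (ℕ; zero; suc; _+_; _∸_; _<ᵇ_; _≤ᵇ_; _≡ᵇ_)
open import Data.List using (List; []; _∷_; map; upTo; concatMap; foldr; length; filterᵇ)
open import Data.Product using (_×_; _,_; proj₁; proj₂)
open import Data.Sign using (Sign; +; -; _*_)
open import Data.Nat using (_≤_; _<_)
open import Relation.Nullary using (¬_)
open import Relation.Binary.PropositionalEquality using (_≡_)

-- Conventions: labels are the natural numbers 1..n.  A sign pattern is a
-- function s : ℕ → ℕ → Sign; the sign of the chord {i,j} (i < j) is  s i j.
-- Values of s at non-chords / out of range / with i ≥ j are irrelevant.

SignPattern : Set
SignPattern = ℕ → ℕ → Sign

rng : ℕ → ℕ → List ℕ
rng a b = map (a +_) (upTo (b ∸ a))

labels : ℕ → List ℕ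
labels n = rng 1 (suc n)

sg : SignPattern → ℕ → ℕ → Sign
sg s i j = if i <ᵇ j then s i j else s j i

isNeg : Sign → Bool
isNeg - = true
isNeg + = false

prodSign : List Sign → Sign
prodSign = foldr _*_ +

-- for 1 ≤ i < j ≤ n : {i,j} is a chord iff i,j are not cyclically adjacent
isChord : ℕ → ℕ → ℕ → Bool
isChord n i j = not (j ≡ᵇ suc i) ∧ not ((i ≡ᵇ 1) ∧ (j ≡ᵇ n))

chords : ℕ → List (ℕ × ℕ)
chords n = concatMap (λ i → concatMap (λ j →
             if (i <ᵇ j) ∧ isChord n i j then (i , j) ∷ [] else []) (labels n)) (labels n)

N : ℕ → SignPattern → ℕ
N n s = length (filterᵇ (λ p → isNeg (sg s (proj₁ p) (proj₂ p))) (chords n))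

monoSign : ℕ → SignPattern → (ℕ → Bool) → (ℕ → Bool) → Sign
monoSign n s P Q = prodSign (concatMap (λ i → concatMap (λ j →
                     if P i ∧ Q j then sg s i j ∷ [] else []) (labels n)) (labels n))

inI : ℕ → ℕ → ℕ → Bool
inI a b x = (a ≤ᵇ x) ∧ (x <ᵇ b)

-- A partition of {1..n} into four non-empty cyclic intervals in cyclic order is
-- given by cut points 1 ≤ a < b < c < d ≤ n:
--   A = [a,b), B = [b,c), C = [c,d), D = [d,n] ∪ [1,a).
-- (Every such partition arises this way, up to the rotation A,B,C,D ↦ B,C,D,A,
--  which only swaps the two monomials; the condition is symmetric.)
Consistent : ℕ → SignPattern → Set
Consistent n s = ∀ (a b c d : ℕ) → 1 ≤ a → a < b → b < c → c < d → d ≤ n →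
  ¬ ( monoSign n s (inI a b) (inI c d) ≡ -
    × monoSign n s (inI b c) (λ x → (d ≤ᵇ x) ∨ (x <ᵇ a)) ≡ - )

-- The dihedral ordering α = 2,1,3,4,…,n  (position ↦ label).
α : ℕ → ℕ
α 1 = 2
α 2 = 1
α p = p

-- Transport t of s to α, on the α-chord {i,j} (labels), via the explicit
-- expressions of v_{ij} = u^α in terms of the u_{kl} (sign of u^{-1} = sign of u):
--   v_ij = u_ij (i,j ∉ {n,1,2});  v_ni = u_ni u_1i;  v_1i = u_1i u_2i;
--   v_2i = u_1i^{-1};  v_n1 = - u_n2 ∏_{i ∉ {n,1,2}} u_1i^{-1}.
transport : ℕ → SignPattern → ℕ → ℕ → Sign
transport n s i j =
  if ((i ≡ᵇ n) ∧ (j ≡ᵇ 1)) ∨ ((i ≡ᵇ 1) ∧ (j ≡ᵇ n))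
    then - * sg s n 2 * prodSign (map (λ k → sg s 1 k) (rng 3 n))
  else if i ≡ᵇ n then sg s n j * sg s 1 j
  else if j ≡ᵇ n then sg s n i * sg s 1 i
  else if i ≡ᵇ 1 then sg s 1 j * sg s 2 j
  else if j ≡ᵇ 1 then sg s 1 i * sg s 2 i
  else if i ≡ᵇ 2 then sg s 1 j
  else if j ≡ᵇ 2 then sg s 1 i
  else sg s i j

Nt : ℕ → SignPattern → ℕ
Nt n s = length (filterᵇ (λ pq → isNeg (transport n s (α (proj₁ pq)) (α (proj₂ pq)))) (chords n))

-- Positions 1 and 2 of α carry labels 2 and 1, so the transported sign of a chord of the α-polygon
-- can differ from the sign of the same position pair under s only for chords through positions 2 or n:
-- chords {1,j} and {i,j} with 3 ≤ i, j < n keep their sign (v₂ⱼ = u₁ⱼ⁻¹, vᵢⱼ = uᵢⱼ).  The other chords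
-- are the pairs {2,k}, {k,n} (3 ≤ k < n), with transported signs s(u₁ₖ)s(u₂ₖ) and s(u₁ₖ)s(uₖₙ), and the
-- chord {2,n}.  A pair can gain negative signs only if s(u₁ₖ) = −; then the u-relations with A = {1},
-- D = {n} and B = [2,k), [2,k+1), [3,k), [3,k+1) force s(u₂ₖ) = − (and k > 3) or s(uₖₙ) = − (and
-- k+1 < n), so the pair has no more negative signs than before.  The chord {2,n} is lost: the relation
-- with A = {1}, B = {2}, C = [3,n), D = {n} and s(u₂ₙ) = − forces ∏ s(u₁ᵢ) = +, so v₁ₙ = −u_{n2}∏u₁ᵢ⁻¹
-- is positive.
module Submission where

open import Defs
open import Algebra.Bundles using (CommutativeMonoid)
open import Data.Bool using (Bool; true; false; if_then_else_; _∧_; _∨_)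
open import Data.Bool.Properties using (∧-zeroʳ; ∧-identityʳ; ∨-identityʳ)
open import Data.List using (List; []; _∷_; _++_; _∷ʳ_; map; foldr; concatMap; length; filterᵇ; upTo)
open import Data.List.Properties using (filter-++; map-++; ++-assoc; ++-identityʳ; upTo-∷ʳ; length-++)
open import Data.List.Membership.Propositional using (_∈_)
open import Data.List.Membership.Propositional.Properties using (∈-map⁻; ∈-upTo⁻)
open import Data.List.Relation.Unary.Any using (here; there)
open import Data.Nat
  using (ℕ; suc; _+_; _∸_; _≤_; _<_; _≤?_; _<?_; _≟_; _≤′_; ≤′-refl; ≤′-step; z≤n; s≤s; _≤ᵇ_; _<ᵇ_)
open import Data.Nat.Properties
open import Data.Nat.Tactic.RingSolver using (solve-∀)
open import Data.Product using (_×_; _,_; proj₁; map₁)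
open import Data.Sign as Sign using (Sign; -; _*_; opposite)
import Data.Sign.Properties as Signₚ
open import Data.Sum using (_⊎_; inj₁; inj₂) renaming (map to map⊎)
open import Function using (_∘_)
open import Relation.Binary.Bundles using (Setoid)
open import Relation.Binary.Definitions using (tri<; tri≈; tri>)
open import Relation.Binary.PropositionalEquality using (_≡_; refl; sym; trans; cong; cong₂; module ≡-Reasoning)
open import Relation.Nullary using (¬_; yes; no; contradiction)
open import Relation.Nullary.Decidable using (dec-true; dec-false; T?)

rng-empty : ∀ {a b} → b ≤ a → rng a b ≡ []
rng-empty {a} b≤a rewrite m≤n⇒m∸n≡0 b≤a = refl

rng-∷ʳ : ∀ {a b} → a ≤ b → rng a (suc b) ≡ rng a b ∷ʳ b
rng-∷ʳ {a} {b} a≤b = begin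
  map (a +_) (upTo (suc b ∸ a))         ≡⟨ cong (map (a +_) ∘ upTo) (+-∸-assoc 1 a≤b) ⟩
  map (a +_) (upTo (suc (b ∸ a)))       ≡⟨ cong (map (a +_)) (sym (upTo-∷ʳ (b ∸ a))) ⟩
  map (a +_) (upTo (b ∸ a) ∷ʳ (b ∸ a))  ≡⟨ map-++ (a +_) (upTo (b ∸ a)) _ ⟩
  rng a b ∷ʳ (a + (b ∸ a))              ≡⟨ cong (rng a b ∷ʳ_) (m+[n∸m]≡n a≤b) ⟩
  rng a b ∷ʳ b                          ∎
  where open ≡-Reasoning

rng-++ : ∀ {a b c} → a ≤ b → b ≤ c → rng a c ≡ rng a b ++ rng b c
rng-++ {a} {b} a≤b = go ∘ ≤⇒≤′
  where
  open ≡-Reasoning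
  go : ∀ {c} → b ≤′ c → rng a c ≡ rng a b ++ rng b c
  go ≤′-refl = sym (trans (cong (rng a b ++_) (rng-empty (≤-refl {b}))) (++-identityʳ _))
  go {suc c} (≤′-step b≤′c) = begin
    rng a (suc c)              ≡⟨ rng-∷ʳ (≤-trans a≤b (≤′⇒≤ b≤′c)) ⟩
    rng a c ∷ʳ c               ≡⟨ cong (_∷ʳ c) (go b≤′c) ⟩
    (rng a b ++ rng b c) ∷ʳ c  ≡⟨ ++-assoc (rng a b) _ _ ⟩
    rng a b ++ (rng b c ∷ʳ c)  ≡⟨ cong (rng a b ++_) (sym (rng-∷ʳ (≤′⇒≤ b≤′c))) ⟩
    rng a b ++ rng b (suc c)   ∎

rng-single : ∀ a → rng a (suc a) ≡ a ∷ []
rng-single a = trans (rng-∷ʳ ≤-refl) (cong (_∷ʳ a) (rng-empty (≤-refl {a})))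

rng-∷ : ∀ {a b} → a < b → rng a b ≡ a ∷ rng (suc a) b
rng-∷ {a} {b} a<b = trans (rng-++ (n≤1+n a) a<b) (cong (_++ rng (suc a) b) (rng-single a))

∈-rng⁻ : ∀ {a b x} → x ∈ rng a b → a ≤ x × x < b
∈-rng⁻ {a} {b} x∈ with y , y∈ , refl ← ∈-map⁻ (a +_) x∈ = m≤m+n a y , a+y<b
  where
  y<b∸a : y < b ∸ a
  y<b∸a = ∈-upTo⁻ y∈
  a+y<b : a + y < b
  a+y<b = <-≤-trans (+-monoʳ-< a y<b∸a) (≤-reflexive (m+[n∸m]≡n {a} (<⇒≤ (m∸n≢0⇒n<m (m<n⇒n≢0 y<b∸a)))))

inI-true : ∀ {a b x} → a ≤ x → x < b → inI a b x ≡ true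
inI-true {a} {b} {x} a≤x x<b rewrite dec-true (a ≤? x) a≤x = dec-true (x <? b) x<b

inI-below : ∀ {a b x} → x < a → inI a b x ≡ false
inI-below {a} {b} {x} x<a rewrite dec-false (a ≤? x) (<⇒≱ x<a) = refl

inI-above : ∀ {a b x} → b ≤ x → inI a b x ≡ false
inI-above {a} {b} {x} b≤x rewrite dec-false (x <? b) (≤⇒≯ b≤x) = ∧-zeroʳ (a ≤ᵇ x)

module Fold {c ℓ} (M : CommutativeMonoid c ℓ) where
  open CommutativeMonoid M
    using (Carrier; _≈_; _∙_; ε; setoid; ∙-cong; ∙-congˡ; identityˡ; identityʳ; assoc; commutativeSemigroup)
  open import Relation.Binary.Reasoning.Setoid setoid
  open import Algebra.Properties.CommutativeSemigroup commutativeSemigroup using (interchange)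
  module ≈ = Setoid setoid

  ⨀ : List Carrier → Carrier
  ⨀ = foldr _∙_ ε

  fold : {X : Set} → List X → (X → Carrier) → Carrier
  fold xs f = ⨀ (map f xs)

  ⨀-++ : ∀ xs ys → ⨀ (xs ++ ys) ≈ ⨀ xs ∙ ⨀ ys
  ⨀-++ []       ys = ≈.sym (identityˡ (⨀ ys))
  ⨀-++ (x ∷ xs) ys = ≈.trans (∙-congˡ (⨀-++ xs ys)) (≈.sym (assoc x (⨀ xs) (⨀ ys)))

  ⨀-concatMap : ∀ {X : Set} (F : X → List Carrier) xs → ⨀ (concatMap F xs) ≈ fold xs (⨀ ∘ F)
  ⨀-concatMap F []       = ≈.refl
  ⨀-concatMap F (x ∷ xs) = ≈.trans (⨀-++ (F x) (concatMap F xs)) (∙-congˡ (⨀-concatMap F xs))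

  ⨀-if : ∀ b v → ⨀ (if b then v ∷ [] else []) ≈ (if b then v else ε)
  ⨀-if true  v = identityʳ v
  ⨀-if false v = ≈.refl

  fold-++ : ∀ {X : Set} xs ys (f : X → Carrier) → fold (xs ++ ys) f ≈ fold xs f ∙ fold ys f
  fold-++ xs ys f = ≈.trans (≈.reflexive (cong ⨀ (map-++ f xs ys))) (⨀-++ (map f xs) (map f ys))

  fold-∙ : ∀ {X : Set} xs (f g : X → Carrier) → fold xs (λ x → f x ∙ g x) ≈ fold xs f ∙ fold xs g
  fold-∙ []       f g = ≈.sym (identityˡ ε)
  fold-∙ (x ∷ xs) f g = ≈.trans (∙-congˡ (fold-∙ xs f g)) (interchange (f x) (g x) (fold xs f) (fold xs g))

  fold-ε : ∀ {X : Set} (xs : List X) → fold xs (λ _ → ε) ≈ ε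
  fold-ε []       = ≈.refl
  fold-ε (x ∷ xs) = ≈.trans (∙-congˡ (fold-ε xs)) (identityˡ ε)

  fold-cong : ∀ {X : Set} xs {f g : X → Carrier} → (∀ {x} → x ∈ xs → f x ≈ g x) → fold xs f ≈ fold xs g
  fold-cong []       f≈g = ≈.refl
  fold-cong (x ∷ xs) f≈g = ∙-cong (f≈g (here refl)) (fold-cong xs (f≈g ∘ there))

  fold-if-∧ : ∀ {X : Set} b (p : X → Bool) (f : X → Carrier) xs →
    fold xs (λ x → if b ∧ p x then f x else ε) ≈ (if b then fold xs (λ x → if p x then f x else ε) else ε)
  fold-if-∧ true  p f xs = ≈.refl
  fold-if-∧ false p f xs = fold-ε xs

  fold-restrict : ∀ {lo a b hi} (p : ℕ → Bool) (f : ℕ → Carrier) → lo ≤ a → a ≤ b → b ≤ hi →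
    (∀ {x} → lo ≤ x → x < hi → p x ≡ inI a b x) →
    fold (rng lo hi) (λ x → if p x then f x else ε) ≈ fold (rng a b) f
  fold-restrict {lo} {a} {b} {hi} p f lo≤a a≤b b≤hi p≗inI = begin
    fold (rng lo hi) g                                  ≡⟨ cong (λ xs → fold xs g) (rng-++ lo≤a a≤hi) ⟩
    fold (rng lo a ++ rng a hi) g                       ≡⟨ cong (λ xs → fold (rng lo a ++ xs) g) (rng-++ a≤b b≤hi) ⟩
    fold (rng lo a ++ (rng a b ++ rng b hi)) g
      ≈⟨ ≈.trans (fold-++ (rng lo a) _ g) (∙-congˡ (fold-++ (rng a b) (rng b hi) g)) ⟩
    fold (rng lo a) g ∙ (fold (rng a b) g ∙ fold (rng b hi) g)
      ≈⟨ ∙-cong (≈.trans (fold-cong (rng lo a) below) (fold-ε (rng lo a)))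
                (∙-cong (fold-cong (rng a b) within) (≈.trans (fold-cong (rng b hi) above) (fold-ε (rng b hi)))) ⟩
    ε ∙ (fold (rng a b) f ∙ ε)                          ≈⟨ ≈.trans (identityˡ _) (identityʳ _) ⟩
    fold (rng a b) f                                    ∎
    where
    g : ℕ → Carrier
    g x = if p x then f x else ε
    a≤hi : a ≤ hi
    a≤hi = ≤-trans a≤b b≤hi
    below : ∀ {x} → x ∈ rng lo a → g x ≈ ε
    below x∈ with lo≤x , x<a ← ∈-rng⁻ x∈
      rewrite p≗inI lo≤x (<-≤-trans x<a a≤hi) | inI-below {b = b} x<a = ≈.refl
    within : ∀ {x} → x ∈ rng a b → g x ≈ f x
    within x∈ with a≤x , x<b ← ∈-rng⁻ x∈
      rewrite p≗inI (≤-trans lo≤a a≤x) (<-≤-trans x<b b≤hi) | inI-true a≤x x<b = ≈.refl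
    above : ∀ {x} → x ∈ rng b hi → g x ≈ ε
    above x∈ with b≤x , x<hi ← ∈-rng⁻ x∈
      rewrite p≗inI (≤-trans (≤-trans lo≤a a≤b) b≤x) x<hi | inI-above {a} b≤x = ≈.refl

open Fold Signₚ.*-commutativeMonoid using ()
  renaming (fold to ∏; ⨀-concatMap to prodSign-concatMap; ⨀-if to prodSign-if; fold-++ to ∏-++;
            fold-∙ to ∏-*; fold-ε to ∏-+; fold-cong to ∏-cong; fold-if-∧ to ∏-if-∧; fold-restrict to ∏-restrict)
open Fold +-0-commutativeMonoid using ()
  renaming (fold to ∑; fold-++ to ∑-++; fold-∙ to ∑-+; fold-ε to ∑-0; fold-cong to ∑-cong)

∑-mono-≤ : ∀ {X : Set} xs {f g : X → ℕ} → (∀ {x} → x ∈ xs → f x ≤ g x) → ∑ xs f ≤ ∑ xs g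
∑-mono-≤ []       f≤g = z≤n
∑-mono-≤ (x ∷ xs) f≤g = +-mono-≤ (f≤g (here refl)) (∑-mono-≤ xs (f≤g ∘ there))

-- Blocks of chords and the u-relations

module Blocks (s : SignPattern) where

  block : ℕ → ℕ → ℕ → ℕ → Sign
  block a b c d = ∏ (rng a b) λ i → ∏ (rng c d) (sg s i)

  block-split-rows : ∀ {a b c} d e → a ≤ b → b ≤ c → block a c d e ≡ block a b d e * block b c d e
  block-split-rows {a} {b} {c} d e a≤b b≤c =
    trans (cong (λ xs → ∏ xs λ i → ∏ (rng d e) (sg s i)) (rng-++ a≤b b≤c)) (∏-++ (rng a b) (rng b c) _)

  block-split-cols : ∀ a b {c d e} → c ≤ d → d ≤ e → block a b c e ≡ block a b c d * block a b d e
  block-split-cols a b {c} {d} {e} c≤d d≤e = trans (∏-cong (rng a b) λ {i} _ →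
      trans (cong (λ xs → ∏ xs (sg s i)) (rng-++ c≤d d≤e)) (∏-++ (rng c d) (rng d e) (sg s i)))
    (∏-* (rng a b) _ _)

  block-row : ∀ i c d → block i (suc i) c d ≡ ∏ (rng c d) (sg s i)
  block-row i c d rewrite rng-single i = Signₚ.*-identityʳ _

  block-single : ∀ i j → block i (suc i) j (suc j) ≡ sg s i j
  block-single i j rewrite block-row i j (suc j) | rng-single j = Signₚ.*-identityʳ _

  block≡-⇒a<b : ∀ a b c d → block a b c d ≡ - → a < b
  block≡-⇒a<b a b c d eq with a <? b
  ... | yes a<b = a<b
  ... | no  a≮b = contradiction
    (trans (sym eq) (cong (λ xs → ∏ xs λ i → ∏ (rng c d) (sg s i)) (rng-empty (≮⇒≥ a≮b)))) λ ()

  block≡-⇒c<d : ∀ a b c d → block a b c d ≡ - → c < d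
  block≡-⇒c<d a b c d eq with c <? d
  ... | yes c<d = c<d
  ... | no  c≮d = contradiction (trans (sym eq) (trans (∏-cong (rng a b) λ {i} _ →
                    cong (λ xs → ∏ xs (sg s i)) (rng-empty (≮⇒≥ c≮d))) (∏-+ (rng a b)))) λ ()

  monoSign-block : ∀ {n a b c d} (P Q : ℕ → Bool) →
    (∀ {x} → 1 ≤ x → x < suc n → P x ≡ inI a b x) → (∀ {x} → 1 ≤ x → x < suc n → Q x ≡ inI c d x) →
    1 ≤ a → a ≤ b → b ≤ suc n → 1 ≤ c → c ≤ d → d ≤ suc n → monoSign n s P Q ≡ block a b c d
  monoSign-block {n} {a} {b} {c} {d} P Q P≗ Q≗ 1≤a a≤b b≤1+n 1≤c c≤d d≤1+n = begin
    monoSign n s P Q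
      ≡⟨ prodSign-concatMap _ L ⟩
    ∏ L (λ i → prodSign (concatMap (λ j → if P i ∧ Q j then sg s i j ∷ [] else []) L))
      ≡⟨ ∏-cong L (λ {i} _ → trans (prodSign-concatMap _ L) (∏-cong L λ {j} _ → prodSign-if (P i ∧ Q j) _)) ⟩
    ∏ L (λ i → ∏ L λ j → if P i ∧ Q j then sg s i j else Sign.+)
      ≡⟨ ∏-cong L (λ {i} _ → trans (∏-if-∧ (P i) Q (sg s i) L)
                               (cong (λ v → if P i then v else Sign.+) (∏-restrict Q (sg s i) 1≤c c≤d d≤1+n Q≗))) ⟩
    ∏ L (λ i → if P i then ∏ (rng c d) (sg s i) else Sign.+)
      ≡⟨ ∏-restrict P _ 1≤a a≤b b≤1+n P≗ ⟩
    block a b c d ∎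
    where
    open ≡-Reasoning
    L : List ℕ
    L = labels n

  consistent-blocks : ∀ {n b} c {d} → Consistent n s → 1 < b → d ≤ n →
    ¬ (block 1 b c d ≡ - × block b c d (suc n) ≡ -)
  consistent-blocks {n} {b} c {d} consistent 1<b d≤n (X≡- , Y≡-) =
    consistent 1 b c d ≤-refl 1<b b<c c<d d≤n (trans first X≡- , trans second Y≡-)
    where
    b<c : b < c
    b<c = block≡-⇒a<b b c d (suc n) Y≡-
    c<d : c < d
    c<d = block≡-⇒c<d 1 b c d X≡-
    1≤b : 1 ≤ b
    1≤b = <⇒≤ 1<b
    c≤1+n : c ≤ suc n
    c≤1+n = ≤-trans (<⇒≤ c<d) (m≤n⇒m≤1+n d≤n)
    first : monoSign n s (inI 1 b) (inI c d) ≡ block 1 b c d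
    first = monoSign-block _ _ (λ _ _ → refl) (λ _ _ → refl)
              ≤-refl 1≤b (≤-trans (<⇒≤ b<c) c≤1+n) (≤-trans 1≤b (<⇒≤ b<c)) (<⇒≤ c<d) (m≤n⇒m≤1+n d≤n)
    wrap≗ : ∀ {x} → 1 ≤ x → x < suc n → ((d ≤ᵇ x) ∨ (x <ᵇ 1)) ≡ inI d (suc n) x
    wrap≗ {x} 1≤x x<1+n rewrite dec-false (x <? 1) (≤⇒≯ 1≤x) | dec-true (x <? suc n) x<1+n =
      trans (∨-identityʳ _) (sym (∧-identityʳ _))
    second : monoSign n s (inI b c) (λ x → (d ≤ᵇ x) ∨ (x <ᵇ 1)) ≡ block b c d (suc n)
    second = monoSign-block _ _ (λ _ _ → refl) wrap≗
               1≤b (<⇒≤ b<c) c≤1+n (≤-trans 1≤b (<⇒≤ (<-trans b<c c<d))) (m≤n⇒m≤1+n d≤n) ≤-refl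

-- Counting negative chords

indicator : Bool → ℕ
indicator true  = 1
indicator false = 0

indicator≤1 : ∀ b → indicator b ≤ 1
indicator≤1 true  = ≤-refl
indicator≤1 false = z≤n

length-filterᵇ-concatMap : ∀ {X Y : Set} (p : Y → Bool) (F : X → List Y) xs →
  length (filterᵇ p (concatMap F xs)) ≡ ∑ xs (λ x → length (filterᵇ p (F x)))
length-filterᵇ-concatMap p F []       = refl
length-filterᵇ-concatMap p F (x ∷ xs) = begin
  length (filterᵇ p (F x ++ concatMap F xs))               ≡⟨ cong length (filter-++ (T? ∘ p) (F x) _) ⟩
  length (filterᵇ p (F x) ++ filterᵇ p (concatMap F xs))   ≡⟨ length-++ (filterᵇ p (F x)) ⟩
  length (filterᵇ p (F x)) + length (filterᵇ p (concatMap F xs))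
    ≡⟨ cong (length (filterᵇ p (F x)) +_) (length-filterᵇ-concatMap p F xs) ⟩
  length (filterᵇ p (F x)) + ∑ xs (λ x → length (filterᵇ p (F x))) ∎
  where open ≡-Reasoning

length-filterᵇ-if : ∀ {Y : Set} (p : Y → Bool) b v →
  length (filterᵇ p (if b then v ∷ [] else [])) ≡ indicator (b ∧ p v)
length-filterᵇ-if p false v = refl
length-filterᵇ-if p true  v with p v
... | true  = refl
... | false = refl

isChordPair : ℕ → ℕ → ℕ → Bool
isChordPair n i j = (i <ᵇ j) ∧ isChord n i j

isChordPair-true : ∀ {n i j} → 1 < i → suc i < j → isChordPair n i j ≡ true
isChordPair-true {n} {i} {j} 1<i 1+i<j
  rewrite dec-true (i <? j) (<-trans (n<1+n i) 1+i<j) | dec-false (j ≟ suc i) (>⇒≢ 1+i<j)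
        | dec-false (i ≟ 1) (>⇒≢ 1<i) = refl

isChordPair-1n : ∀ n → isChordPair n 1 n ≡ false
isChordPair-1n n rewrite dec-true (n ≟ n) refl = trans (cong ((1 <ᵇ n) ∧_) (∧-zeroʳ _)) (∧-zeroʳ _)

negChord : ℕ → (ℕ → ℕ → Sign) → ℕ → ℕ → ℕ
negChord n σ i j = indicator (isChordPair n i j ∧ isNeg (σ i j))

negChord-eval : ∀ {n} σ i j {v} → σ i j ≡ v → negChord n σ i j ≡ indicator (isChordPair n i j ∧ isNeg v)
negChord-eval {n} σ i j σij≡v = cong (λ v → indicator (isChordPair n i j ∧ isNeg v)) σij≡v

negChord-nonChord : ∀ {n i j} σ → isChordPair n i j ≡ false → negChord n σ i j ≡ 0
negChord-nonChord {n} {i} {j} σ eq = cong (λ b → indicator (b ∧ isNeg (σ i j))) eq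

negChord-≥ : ∀ {n i j} σ → j ≤ i → negChord n σ i j ≡ 0
negChord-≥ {n} {i} {j} σ j≤i = negChord-nonChord σ (cong (_∧ isChord n i j) (dec-false (i <? j) (≤⇒≯ j≤i)))

negChord-col2 : ∀ {n i} σ → 1 ≤ i → negChord n σ i 2 ≡ 0
negChord-col2 {i = 1}           σ _ = refl
negChord-col2 {i = suc (suc i)} σ _ = refl

negCount : ℕ → (ℕ → ℕ → Sign) → ℕ
negCount n σ = ∑ (labels n) λ i → ∑ (labels n) (negChord n σ i)

length-filterᵇ-chords : ∀ n (p : ℕ × ℕ → Bool) →
  length (filterᵇ p (chords n)) ≡
    ∑ (labels n) λ i → ∑ (labels n) λ j → indicator (isChordPair n i j ∧ p (i , j))
length-filterᵇ-chords n p = trans (length-filterᵇ-concatMap p _ (labels n)) (∑-cong (labels n) λ {i} _ →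
  trans (length-filterᵇ-concatMap p _ (labels n))
        (∑-cong (labels n) λ {j} _ → length-filterᵇ-if p (isChordPair n i j) (i , j)))

N≡negCount : ∀ n s → N n s ≡ negCount n (sg s)
N≡negCount n s = length-filterᵇ-chords n _

labels∖2n : ℕ → List ℕ
labels∖2n n = 1 ∷ rng 3 n

∈-labels∖2n⁻ : ∀ {n j} → j ∈ labels∖2n n → j ≡ 1 ⊎ (3 ≤ j × j < n)
∈-labels∖2n⁻ (here j≡1) = inj₁ j≡1
∈-labels∖2n⁻ (there j∈) = inj₂ (∈-rng⁻ j∈)

labels≡ : ∀ {n} → 3 ≤ n → labels n ≡ 1 ∷ 2 ∷ rng 3 n ++ n ∷ []
labels≡ {n} 3≤n = trans (rng-∷ʳ (≤-trans (s≤s z≤n) 3≤n))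
  (cong (_∷ʳ n) (trans (rng-∷ (≤-trans (s≤s (s≤s z≤n)) 3≤n)) (cong (1 ∷_) (rng-∷ 3≤n))))

∑-labels : ∀ {n} → 3 ≤ n → ∀ f → ∑ (labels n) f ≡ ∑ (labels∖2n n) f + (f 2 + f n)
∑-labels {n} 3≤n f rewrite labels≡ 3≤n | ∑-++ (rng 3 n) (n ∷ []) f =
  rearrange (f 1) (f 2) (∑ (rng 3 n) f) (f n)
  where
  rearrange : ∀ a b c d → a + (b + (c + (d + 0))) ≡ a + c + (b + d)
  rearrange = solve-∀

negCountAway negCountHook : ℕ → (ℕ → ℕ → Sign) → ℕ
negCountAway n σ = ∑ (labels∖2n n) λ i → ∑ (labels∖2n n) (negChord n σ i)
negCountHook n σ = ∑ (labels∖2n n) λ k → negChord n σ 2 k + negChord n σ k n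

negCount-split : ∀ {n} σ → 3 ≤ n → negCount n σ ≡ negCountAway n σ + negCountHook n σ + negChord n σ 2 n
negCount-split {n} σ 3≤n = begin
  ∑ L (λ i → ∑ L (c i))                         ≡⟨ ∑-cong L (λ {i} _ → ∑-labels 3≤n (c i)) ⟩
  ∑ L (λ i → S (c i) + (c i 2 + c i n))
    ≡⟨ ∑-cong L {λ i → S (c i) + (c i 2 + c i n)} (λ {i} i∈ →
         cong (λ z → S (c i) + (z + c i n)) (negChord-col2 {n} σ (proj₁ (∈-rng⁻ {b = suc n} i∈)))) ⟩
  ∑ L (λ i → S (c i) + c i n)                   ≡⟨ ∑-labels 3≤n _ ⟩
  S (λ i → S (c i) + c i n) + ((S (c 2) + c 2 n) + (S (c n) + c n n))
    ≡⟨ cong₂ (λ x y → x + ((S (c 2) + c 2 n) + y)) (∑-+ L′ (λ i → S (c i)) (λ i → c i n)) lastRow≡0 ⟩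
  S (λ i → S (c i)) + S (λ k → c k n) + ((S (c 2) + c 2 n) + 0)
    ≡⟨ rearrange (S (λ i → S (c i))) (S (λ k → c k n)) (S (c 2)) (c 2 n) ⟩
  S (λ i → S (c i)) + (S (c 2) + S (λ k → c k n)) + c 2 n
    ≡⟨ cong (λ x → S (λ i → S (c i)) + x + c 2 n) (sym (∑-+ L′ (c 2) (λ k → c k n))) ⟩
  S (λ i → S (c i)) + S (λ k → c 2 k + c k n) + c 2 n ∎
  where
  open ≡-Reasoning
  L L′ : List ℕ
  L = labels n
  L′ = labels∖2n n
  S : (ℕ → ℕ) → ℕ
  S = ∑ L′
  c : ℕ → ℕ → ℕ
  c = negChord n σ
  j∈L′⇒j≤n : ∀ {j} → j ∈ L′ → j ≤ n
  j∈L′⇒j≤n j∈ with ∈-labels∖2n⁻ j∈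
  ... | inj₁ refl      = ≤-trans (s≤s z≤n) 3≤n
  ... | inj₂ (_ , j<n) = <⇒≤ j<n
  lastRow≡0 : S (c n) + c n n ≡ 0
  lastRow≡0 = cong₂ _+_ (trans (∑-cong L′ (negChord-≥ σ ∘ j∈L′⇒j≤n)) (∑-0 L′)) (negChord-≥ σ ≤-refl)
  rearrange : ∀ a b x y → a + b + ((x + y) + 0) ≡ a + (x + b) + y
  rearrange = solve-∀

hook-count : ∀ p q x z w → (x ≡ - → (p ≡ true × z ≡ -) ⊎ (q ≡ true × w ≡ -)) →
  indicator (p ∧ isNeg (x * z)) + indicator (q ∧ isNeg (x * w)) ≤ indicator (p ∧ isNeg z) + indicator (q ∧ isNeg w)
hook-count p q Sign.+ z w _ = ≤-refl
hook-count p q - z w h with h refl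
... | inj₁ (refl , refl) = ≤-trans (indicator≤1 (q ∧ isNeg (opposite w))) (s≤s z≤n)
... | inj₂ (refl , refl) = ≤-trans (+-monoˡ-≤ 0 (indicator≤1 (p ∧ isNeg (opposite z)))) (m≤n+m 1 _)

-- The transported signs

sg-sym : ∀ s i j → sg s i j ≡ sg s j i
sg-sym s i j with <-cmp i j
... | tri< i<j _ _ rewrite dec-true (i <? j) i<j | dec-false (j <? i) (<⇒≯ i<j) = refl
... | tri≈ _ refl _ = refl
... | tri> _ _ j<i rewrite dec-false (i <? j) (<⇒≯ j<i) | dec-true (j <? i) j<i = refl

α-fix : ∀ {p} → 3 ≤ p → α p ≡ p
α-fix (s≤s (s≤s (s≤s _))) = refl

tα : ℕ → SignPattern → ℕ → ℕ → Sign
tα n s p q = transport n s (α p) (α q)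

Nt≡negCount : ∀ n s → Nt n s ≡ negCount n (tα n s)
Nt≡negCount n s = length-filterᵇ-chords n _

module _ {n : ℕ} (s : SignPattern) where

  tα-row1 : ∀ {j} → 3 ≤ j → j < n → tα n s 1 j ≡ sg s 1 j
  tα-row1 {j} 3≤j@(s≤s (s≤s (s≤s _))) j<n
    rewrite dec-false (2 ≟ n) (<⇒≢ (<-trans 3≤j j<n)) | dec-false (j ≟ n) (<⇒≢ j<n) = refl

  tα-inner : ∀ {i j} → 3 ≤ i → i < n → 3 ≤ j → j < n → tα n s i j ≡ sg s i j
  tα-inner {i} {j} (s≤s (s≤s (s≤s _))) i<n (s≤s (s≤s (s≤s _))) j<n
    rewrite dec-false (i ≟ n) (<⇒≢ i<n) | dec-false (j ≟ n) (<⇒≢ j<n) = refl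

  tα-row2 : ∀ {k} → 3 ≤ k → k < n → tα n s 2 k ≡ sg s 1 k * sg s 2 k
  tα-row2 {k} 3≤k@(s≤s (s≤s (s≤s _))) k<n
    rewrite dec-false (1 ≟ n) (<⇒≢ (<-trans (s≤s (s≤s z≤n)) (<-trans 3≤k k<n)))
          | dec-false (k ≟ n) (<⇒≢ k<n) = refl

  tα-coln : ∀ {k} → 3 ≤ k → k < n → tα n s k n ≡ sg s 1 k * sg s k n
  tα-coln {k} 3≤k@(s≤s (s≤s (s≤s _))) k<n
    rewrite α-fix (≤-trans 3≤k (<⇒≤ k<n)) | dec-false (k ≟ n) (<⇒≢ k<n) | dec-true (n ≟ n) refl =
    trans (cong (_* sg s 1 k) (sg-sym s n k)) (Signₚ.*-comm (sg s k n) (sg s 1 k))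

  tα-corner : 3 ≤ n → tα n s 2 n ≡ - * sg s n 2 * ∏ (rng 3 n) (sg s 1)
  tα-corner 3≤n
    rewrite α-fix 3≤n | dec-false (1 ≟ n) (<⇒≢ (≤-trans (s≤s (s≤s z≤n)) 3≤n)) | dec-true (n ≟ n) refl = refl

negCountAway-tα : ∀ n s → negCountAway n (tα n s) ≡ negCountAway n (sg s)
negCountAway-tα n s = ∑-cong L′ λ i∈ → ∑-cong L′ λ j∈ → agree i∈ j∈
  where
  L′ : List ℕ
  L′ = labels∖2n n
  agree : ∀ {i j} → i ∈ L′ → j ∈ L′ → negChord n (tα n s) i j ≡ negChord n (sg s) i j
  agree {i} {j} i∈ j∈ with ∈-labels∖2n⁻ i∈ | ∈-labels∖2n⁻ j∈
  ... | inj₁ refl                    | inj₁ refl        = refl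
  ... | inj₂ (s≤s (s≤s (s≤s _)) , _) | inj₁ refl        = refl
  ... | inj₁ refl                    | inj₂ (3≤j , j<n) = negChord-eval (tα n s) 1 j (tα-row1 s 3≤j j<n)
  ... | inj₂ (3≤i , i<n)             | inj₂ (3≤j , j<n) = negChord-eval (tα n s) i j (tα-inner s 3≤i i<n 3≤j j<n)

-- Consequences of consistency

≢-⇒≡+ : ∀ {x} → ¬ x ≡ - → x ≡ Sign.+
≢-⇒≡+ {Sign.+} _ = refl
≢-⇒≡+ { - }    x≢- = contradiction refl x≢-

-- For x = s(u₁ₖ), y = s(u₂ₙ), z = s(u₂ₖ), w = s(uₖₙ), A₁ = ∏_{k<j<n} s(u₁ⱼ), A₂ = ∏_{k<j<n} s(u₂ⱼ) and
-- B = ∏_{3≤i<k} s(uᵢₙ), the four hypotheses are the relations with A = {1}, D = {n} and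
-- B = [2,k), [2,k+1), [3,k), [3,k+1) respectively.
four-relations : ∀ {x y} A₁ A₂ B z w → x ≡ - → y ≡ - →
  ¬ (x * A₁ ≡ - × y * B ≡ -) →
  ¬ (A₁ ≡ - × (y * B) * w ≡ -) →
  ¬ ((x * A₁) * (z * A₂) ≡ - × B ≡ -) →
  ¬ (A₁ * A₂ ≡ - × B * w ≡ -) →
  (B ≡ - × z ≡ -) ⊎ (A₂ ≡ - × w ≡ -)
four-relations _      _      -      -      _      refl refl _  _  _  _  = inj₁ (refl , refl)
four-relations Sign.+ Sign.+ -      Sign.+ _      refl refl _  _  h₃ _  = contradiction (refl , refl) h₃
four-relations Sign.+ -      -      Sign.+ Sign.+ refl refl _  _  _  h₄ = contradiction (refl , refl) h₄
four-relations Sign.+ -      -      Sign.+ -      refl refl _  _  _  _  = inj₂ (refl , refl)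
four-relations -      -      -      Sign.+ _      refl refl _  _  h₃ _  = contradiction (refl , refl) h₃
four-relations -      Sign.+ -      Sign.+ Sign.+ refl refl _  _  _  h₄ = contradiction (refl , refl) h₄
four-relations -      Sign.+ -      Sign.+ -      refl refl _  h₂ _  _  = contradiction (refl , refl) h₂
four-relations Sign.+ _      Sign.+ _      _      refl refl h₁ _  _  _  = contradiction (refl , refl) h₁
four-relations -      _      Sign.+ _      Sign.+ refl refl _  h₂ _  _  = contradiction (refl , refl) h₂
four-relations -      -      Sign.+ _      -      refl refl _  _  _  _  = inj₂ (refl , refl)
four-relations -      Sign.+ Sign.+ _      -      refl refl _  _  _  h₄ = contradiction (refl , refl) h₄

module _ {n : ℕ} {s : SignPattern} (consistent : Consistent n s) (u2n≡- : sg s 2 n ≡ -) where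
  open Blocks s

  ∏-row1≡+ : ∏ (rng 3 n) (sg s 1) ≡ Sign.+
  ∏-row1≡+ = ≢-⇒≡+ λ ∏≡- →
    consistent-blocks 3 consistent (n<1+n 1) ≤-refl (trans (block-row 1 3 n) ∏≡- , trans (block-single 2 n) u2n≡-)

  hook-signs : ∀ {k} → 3 ≤ k → k < n → sg s 1 k ≡ - →
    (3 < k × sg s 2 k ≡ -) ⊎ (suc k < n × sg s k n ≡ -)
  hook-signs {k} 3≤k k<n u1k≡- =
    map⊎ (map₁ (block≡-⇒a<b 3 k n (suc n))) (map₁ (block≡-⇒c<d 2 3 (suc k) n))
      (four-relations A₁ A₂ B (sg s 2 k) (sg s k n) u1k≡- u2n≡-
        (consistent-at k 1<2 e₁ e₂) (consistent-at (suc k) 1<2 refl e₃)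
        (consistent-at k 1<3 e₄ refl) (consistent-at (suc k) 1<3 e₆ e₇))
    where
    1<2 : 1 < 2
    1<2 = n<1+n 1
    1<3 : 1 < 3
    1<3 = s≤s (s≤s z≤n)
    consistent-at : ∀ {b} c {X Y} → 1 < b → block 1 b c n ≡ X → block b c n (suc n) ≡ Y → ¬ (X ≡ - × Y ≡ -)
    consistent-at c 1<b refl refl = consistent-blocks c consistent 1<b ≤-refl
    A₁ A₂ B : Sign
    A₁ = block 1 2 (suc k) n
    A₂ = block 2 3 (suc k) n
    B  = block 3 k n (suc n)
    peel-col : ∀ i → block i (suc i) k n ≡ sg s i k * block i (suc i) (suc k) n
    peel-col i = trans (block-split-cols i (suc i) (n≤1+n k) k<n) (cong (_* block i (suc i) (suc k) n) (block-single i k))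
    e₁ : block 1 2 k n ≡ sg s 1 k * A₁
    e₁ = peel-col 1
    e₂ : block 2 k n (suc n) ≡ sg s 2 n * B
    e₂ = trans (block-split-rows n (suc n) (n≤1+n 2) 3≤k) (cong (_* B) (block-single 2 n))
    e₃ : block 2 (suc k) n (suc n) ≡ (sg s 2 n * B) * sg s k n
    e₃ = trans (block-split-rows n (suc n) (≤-trans (n≤1+n 2) 3≤k) (n≤1+n k)) (cong₂ _*_ e₂ (block-single k n))
    e₄ : block 1 3 k n ≡ (sg s 1 k * A₁) * (sg s 2 k * A₂)
    e₄ = trans (block-split-rows k n (n≤1+n 1) (n≤1+n 2)) (cong₂ _*_ e₁ (peel-col 2))
    e₆ : block 1 3 (suc k) n ≡ A₁ * A₂
    e₆ = block-split-rows (suc k) n (n≤1+n 1) (n≤1+n 2)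
    e₇ : block 3 (suc k) n (suc n) ≡ B * sg s k n
    e₇ = trans (block-split-rows n (suc n) 3≤k (n≤1+n k)) (cong (B *_) (block-single k n))

  negCountHook-tα : negCountHook n (tα n s) ≤ negCountHook n (sg s)
  negCountHook-tα = ∑-mono-≤ (labels∖2n n) hook-term
    where
    hook-term : ∀ {k} → k ∈ labels∖2n n →
      negChord n (tα n s) 2 k + negChord n (tα n s) k n ≤ negChord n (sg s) 2 k + negChord n (sg s) k n
    hook-term {k} k∈ with ∈-labels∖2n⁻ k∈
    ... | inj₁ refl = ≤-reflexive (trans (negChord-nonChord {n} {1} {n} (tα n s) (isChordPair-1n n))
                                         (sym (negChord-nonChord {n} {1} {n} (sg s) (isChordPair-1n n))))
    ... | inj₂ (3≤k , k<n) = begin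
      negChord n (tα n s) 2 k + negChord n (tα n s) k n
        ≡⟨ cong₂ _+_ (negChord-eval {n} (tα n s) 2 k (tα-row2 s 3≤k k<n))
                     (negChord-eval {n} (tα n s) k n (tα-coln s 3≤k k<n)) ⟩
      indicator (isChordPair n 2 k ∧ isNeg (sg s 1 k * sg s 2 k))
        + indicator (isChordPair n k n ∧ isNeg (sg s 1 k * sg s k n))
        ≤⟨ hook-count _ _ (sg s 1 k) _ _
             (map⊎ (map₁ (isChordPair-true {n} 1<2)) (map₁ (isChordPair-true {n} 1<k)) ∘ hook-signs 3≤k k<n) ⟩
      negChord n (sg s) 2 k + negChord n (sg s) k n ∎
      where
      open ≤-Reasoning
      1<2 : 1 < 2
      1<2 = n<1+n 1
      1<k : 1 < k
      1<k = ≤-trans (s≤s (s≤s z≤n)) 3≤k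

  negChord-corner : 3 < n → negChord n (tα n s) 2 n < negChord n (sg s) 2 n
  negChord-corner 3<n = begin-strict
    negChord n (tα n s) 2 n
      ≡⟨ negChord-eval {n} (tα n s) 2 n
           (trans (tα-corner s (<⇒≤ 3<n)) (cong₂ (λ u v → - * u * v) un2≡- ∏-row1≡+)) ⟩
    indicator (isChordPair n 2 n ∧ false) ≡⟨ cong indicator (∧-zeroʳ _) ⟩
    0                                     <⟨ s≤s z≤n ⟩
    1
      ≡⟨ cong₂ (λ p v → indicator (p ∧ isNeg v)) (isChordPair-true {n} (n<1+n 1) 3<n) u2n≡- ⟨
    negChord n (sg s) 2 n                 ∎
    where
    open ≤-Reasoning
    un2≡- : sg s n 2 ≡ -
    un2≡- = trans (sg-sym s n 2) u2n≡-

proposition3p2 : (n : ℕ) → 4 ≤ n → (s : SignPattern) → Consistent n s →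
    sg s n 2 ≡ - → Nt n s < N n s
proposition3p2 n 3<n s consistent un2≡- = begin-strict
  Nt n s                                                                   ≡⟨ Nt≡negCount n s ⟩
  negCount n (tα n s)                                                      ≡⟨ negCount-split (tα n s) 3≤n ⟩
  negCountAway n (tα n s) + negCountHook n (tα n s) + negChord n (tα n s) 2 n
    <⟨ +-mono-≤-< (+-mono-≤ (≤-reflexive (negCountAway-tα n s)) (negCountHook-tα consistent u2n≡-))
                  (negChord-corner consistent u2n≡- 3<n) ⟩
  negCountAway n (sg s) + negCountHook n (sg s) + negChord n (sg s) 2 n    ≡⟨ negCount-split (sg s) 3≤n ⟨
  negCount n (sg s)                                                        ≡⟨ N≡negCount n s ⟨
  N n s                                                                    ∎
  where
  open ≤-Reasoning
  3≤n : 3 ≤ n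
  3≤n = <⇒≤ 3<n
  u2n≡- : sg s 2 n ≡ -
  u2n≡- = trans (sg-sym s 2 n) un2≡-
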